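{- Let $t\ge2$, $k_1\ge\cdots\ge k_t$ be positive integers, $n\ge k_1+k_2$, $i\in[t]$, $m=\min_{j\ne i}k_j$, and assume $n>k_1+k_2$ or $t>2$. Let $m+1\le j\le m+k_i-1$. If $f(\{m,m+1,\dots,j\})\le f(\{m,m+1,\dots,j-1\})$, then $f(\{m,m+1,\dots,j-1\})<f(\{m,m+1,\dots,j-2\})$.
   Context: Lexicographic order: $A\prec B$ if $A\supseteq B$ or $\min(A\setminus B)<\min(B\setminus A)$; $\mathcal{L}([n],R,k)=\{F\in\binom{[n]}{k}:F\prec R\}$. The partner of a set $A$ with $q=\max A$ is the set $B$ with $A\cap B=\{q\}$ and $A\cup B=[q]$. For a $k_i$-set $R$ with partner $T$, $f_i(R)=|\mathcal{L}([n],R,k_i)|+\sum_{p\ne i}|\mathcal{L}([n],T,k_p)|$. For a set $X\subset[n]$ with $|X|\le k_i$, $f(X)$ denotes $f_i(X\cup[n-k_i+|X|+1,n])$, i.e. $f_i$ of the $k_i$-set obtained by adding the largest $k_i-|X|$ elements of $[n]$. -}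

module Defs where

open import Data.Nat using (ℕ; zero; suc; _+_; _∸_; _≤_; _<_; _≤?_)
open import Data.Nat.Properties using () renaming (_≟_ to _≟ℕ_)
open import Data.Bool using (Bool; true; false; _∧_)
open import Data.Fin using (Fin; toℕ; _≟_) renaming (_<_ to _<ᶠ_; _≤_ to _≤ᶠ_)
open import Data.Fin.Properties using (any?; all?) renaming (_<?_ to _<ᶠ?_; _≤?_ to _≤ᶠ?_)
open import Data.Fin.Subset using (Subset; _∈_; _∉_; _⊆_; ∣_∣; inside; outside; _∪_)
open import Data.Fin.Subset.Properties using (_∈?_; _⊆?_)
open import Data.Vec using (Vec; []; _∷_; tabulate)
open import Data.List using (List; []; _∷_; map; _++_; filter; length; allFin)
open import Data.Nat.ListAction using (sum)
open import Data.Product using (_×_; ∃; _,_)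
open import Data.Sum using (_⊎_)
open import Relation.Nullary using (Dec; ¬_; ¬?; yes; no)
open import Relation.Nullary.Decidable using (_×-dec_; _⊎-dec_; _→-dec_; ⌊_⌋)
open import Relation.Binary.PropositionalEquality using (_≡_)

-- CONVENTION: a subset of [n] = {1,…,n} is a Subset n (Vec Bool n);
-- the element x ∈ [n] is encoded by the index x - 1 : Fin n.  This
-- encoding preserves the order, so Fin's order is the order on [n].

allSubsets : (n : ℕ) → List (Subset n)
allSubsets zero = [] ∷ []
allSubsets (suc n) = map (inside ∷_) (allSubsets n) ++ map (outside ∷_) (allSubsets n)

-- Lexicographic order: A ≺ B iff A ⊇ B or min(A∖B) < min(B∖A).
-- For B ⊈ A, B∖A ≠ ∅, and "min(A∖B) < min(B∖A)" says exactly that some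
-- a ∈ A∖B lies below every element of B∖A (min ∅ never compares).
_≺_ : {n : ℕ} → Subset n → Subset n → Set
A ≺ B = (B ⊆ A) ⊎ ∃ λ a → (a ∈ A × a ∉ B) × (∀ b → (b ∈ B × b ∉ A) → a <ᶠ b)

_≺?_ : {n : ℕ} → (A B : Subset n) → Dec (A ≺ B)
A ≺? B = (B ⊆? A) ⊎-dec any? (λ a → ((a ∈? A) ×-dec ¬? (a ∈? B)) ×-dec
           all? (λ b → ((b ∈? B) ×-dec ¬? (b ∈? A)) →-dec (a <ᶠ? b)))

Lsize : (n : ℕ) → Subset n → ℕ → ℕ
Lsize n R k = length (filter (λ F → (∣ F ∣ ≟ℕ k) ×-dec (F ≺? R)) (allSubsets n))

-- Partner of A (nonempty) with q = max A: the set T with A ∩ T = {q} and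
-- A ∪ T = [q], i.e. T = ([q] ∖ A) ∪ {q}.
partner : {n : ℕ} → Subset n → Subset n
partner A = tabulate λ x →
  ⌊ ((x ∈? A) ×-dec all? (λ y → (y ∈? A) →-dec (y ≤ᶠ? x)))
    ⊎-dec (¬? (x ∈? A) ×-dec any? (λ y → (y ∈? A) ×-dec (x <ᶠ? y))) ⌋

f-i : {t : ℕ} → (n : ℕ) → (k : Fin t → ℕ) → (i : Fin t) → Subset n → ℕ
f-i {t} n k i R =
  Lsize n R (k i)
  + sum (map (λ p → Lsize n (partner R) (k p)) (filter (λ p → ¬? (p ≟ i)) (allFin t)))

interval : (n : ℕ) → ℕ → ℕ → Subset n
interval n a b = tabulate λ x → ⌊ a ≤? suc (toℕ x) ⌋ ∧ ⌊ suc (toℕ x) ≤? b ⌋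

f : {t : ℕ} → (n : ℕ) → (k : Fin t → ℕ) → (i : Fin t) → Subset n → ℕ
f n k i X = f-i n k i (X ∪ interval n ((n ∸ k i) + ∣ X ∣ + 1) n)

-- Write m = M + 1 and let X = {m, …, M + a}, b = k_i − a and G = n − M − k_i.  The set
-- R = X ∪ [n − k_i + a + 1, n] at which f(X) evaluates f_i has characteristic word 0^M 1^a 0^G 1^b,
-- and its partner has the word 1^M 0^a 1^G 0^(b−1) 1 (or 1^M 0^(a−1) 1 0^G when b = 0).  Counting
-- lexicographic predecessors of such words gives, with c_p = k_p − m,
--   f(X) + C(n−M, k_i) + Σ_{p≠i} C(G+b, c_p+1) = C(n, k_i) + C(G+b, b) + Σ_{p≠i} C(n−M, c_p+1).
-- By Pascal's rule, removing the largest element of X therefore raises f by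
-- C(G+b, b+1) − Σ_{p≠i} C(G+b, c_p), and with N = G + b the lemma becomes: if
-- Σ_p C(N, c_p) ≤ C(N, b+1) then Σ_p C(N+1, c_p) < C(N+1, b+2).  With u = b + 1 this holds
-- because (u+1)·C(N+1, c) ≤ (N+1)·C(N, c) whenever c + u ≤ N, strictly for c = 0 (the c_p with
-- k_p = m) when u < N, while (N+1)·C(N, u) = (u+1)·C(N+1, u+1).  The case u = N forces every c_p
-- to be 0, which is excluded by n > k_1 + k_2 (then N > u) or t > 2 (then the sum has two terms).

module Submission where

open import Defs
open import Data.Bool using (Bool; true; false; T; not; _∧_; _∨_; if_then_else_)
open import Data.Bool.Properties using (if-eta; ∨-zeroʳ; T-≡; T-∧; T-∨)
open import Data.Empty using (⊥-elim)
open import Data.Fin using (Fin; zero; suc; toℕ; fromℕ<) renaming (_≤_ to _≤ᶠ_; _<_ to _<ᶠ_)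
open import Data.Fin.Properties using (toℕ<n; toℕ-fromℕ<)
import Data.Fin.Properties as Finₚ
open import Data.Fin.Subset using (Subset; inside; outside; ∣_∣; _∪_) renaming (_∈_ to _∈ₛ_; _∉_ to _∉ₛ_)
open import Data.List using (List; []; _∷_; map; _++_; filter; length; replicate; applyUpTo; allFin; tabulate)
open import Data.List.Properties
  using (length-++; length-replicate; length-map; length-applyUpTo; length-tabulate; ++-identityʳ;
         filter-++; filter-≐; filter-none; filter-all; map-cong; map-cong-local; map-∘; map-tabulate)
open import Data.List.Membership.Propositional using (_∈_)
open import Data.List.Membership.Propositional.Properties using (∈-map⁺; ∈-filter⁺; ∈-allFin)
open import Data.List.Relation.Unary.All as All using (All; []; _∷_)
open import Data.List.Relation.Unary.All.Properties using (all-filter; tabulate⁺; map⁺)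
open import Data.List.Relation.Unary.Any using (here; there)
open import Data.Nat using (ℕ; zero; suc; _+_; _*_; _∸_; _≤_; _<_; _≤ᵇ_; _<ᵇ_; _≡ᵇ_; z≤n; s≤s; _≤?_)
open import Data.Nat.Combinatorics using (_C_; nCn≡1; nC1≡n; nCk+nC[k+1]≡[n+1]C[k+1])
open import Data.Nat.ListAction using (sum)
open import Data.Nat.Properties renaming (_≟_ to _≟ℕ_)
open import Data.Nat.Tactic.RingSolver using (solve-∀)
open import Algebra.Properties.CommutativeSemigroup +-commutativeSemigroup using (interchange)
open import Data.Product using (_×_; ∃; _,_; proj₁; proj₂)
open import Data.Sum using (_⊎_; inj₁; inj₂; [_,_])
import Data.Sum as Sum
open import Data.Vec using ([]; _∷_; lookup; toList; here; there)
open import Data.Vec.Properties using (length-toList; lookup∘tabulate; lookup-zipWith; []=⇒lookup; lookup⇒[]=)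
open import Function using (id; _∘_)
open import Function.Bundles using (Equivalence)
open import Level using (0ℓ)
open import Relation.Nullary using (¬_; Dec; does; _because_; ¬?; T?)
open import Relation.Nullary.Decidable using (⌊_⌋; _×-dec_)
open import Relation.Nullary.Reflects using (Reflects; det; fromEquivalence)
open import Relation.Unary using (Pred; Decidable)
open import Relation.Binary.PropositionalEquality
  using (_≡_; _≢_; refl; sym; trans; cong; cong₂; subst; subst₂; module ≡-Reasoning)

-- Binomial coefficients

[1+k]*[1+n]C[1+k]≡[1+n]*nCk : ∀ n k → suc k * (suc n C suc k) ≡ suc n * (n C k)
[1+k]*[1+n]C[1+k]≡[1+n]*nCk zero    zero    = refl
[1+k]*[1+n]C[1+k]≡[1+n]*nCk zero    (suc k) = *-zeroʳ (suc (suc k))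
[1+k]*[1+n]C[1+k]≡[1+n]*nCk (suc n) zero    =
  trans (*-identityˡ _) (trans (nC1≡n (suc (suc n))) (sym (*-identityʳ _)))
[1+k]*[1+n]C[1+k]≡[1+n]*nCk (suc n) (suc k) = begin
  suc (suc k) * (suc (suc n) C suc (suc k))
    ≡⟨ cong (suc (suc k) *_) (sym (nCk+nC[k+1]≡[n+1]C[k+1] (suc n) (suc k))) ⟩
  suc (suc k) * (X + Y)
    ≡⟨ expand k X Y ⟩
  X + (suc k * X + suc (suc k) * Y)
    ≡⟨ cong₂ (λ u v → u + (v + suc (suc k) * Y)) (sym (nCk+nC[k+1]≡[n+1]C[k+1] n k)) ([1+k]*[1+n]C[1+k]≡[1+n]*nCk n k) ⟩
  (n C k + n C suc k) + (suc n * (n C k) + suc (suc k) * Y)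
    ≡⟨ cong (λ v → (n C k + n C suc k) + (suc n * (n C k) + v)) ([1+k]*[1+n]C[1+k]≡[1+n]*nCk n (suc k)) ⟩
  (n C k + n C suc k) + (suc n * (n C k) + suc n * (n C suc k))
    ≡⟨ collect n (n C k) (n C suc k) ⟩
  suc (suc n) * (n C k + n C suc k)
    ≡⟨ cong (suc (suc n) *_) (nCk+nC[k+1]≡[n+1]C[k+1] n k) ⟩
  suc (suc n) * (suc n C suc k) ∎
  where
  open ≡-Reasoning
  X Y : ℕ
  X = suc n C suc k
  Y = suc n C suc (suc k)
  expand : ∀ k X Y → suc (suc k) * (X + Y) ≡ X + (suc k * X + suc (suc k) * Y)
  expand = solve-∀
  collect : ∀ n P Q → (P + Q) + (suc n * P + suc n * Q) ≡ suc (suc n) * (P + Q)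
  collect = solve-∀

[1+n]*[1+n]Ck≡[1+n]*nCk+k*[1+n]Ck : ∀ n k → suc n * (suc n C k) ≡ suc n * (n C k) + k * (suc n C k)
[1+n]*[1+n]Ck≡[1+n]*nCk+k*[1+n]Ck n zero    = sym (+-identityʳ _)
[1+n]*[1+n]Ck≡[1+n]*nCk+k*[1+n]Ck n (suc k) = begin
  suc n * (suc n C suc k)                       ≡⟨ cong (suc n *_) (nCk+nC[k+1]≡[n+1]C[k+1] n k) ⟨
  suc n * (n C k + n C suc k)                   ≡⟨ *-distribˡ-+ (suc n) (n C k) _ ⟩
  suc n * (n C k) + suc n * (n C suc k)         ≡⟨ cong (_+ suc n * (n C suc k)) ([1+k]*[1+n]C[1+k]≡[1+n]*nCk n k) ⟨
  suc k * (suc n C suc k) + suc n * (n C suc k) ≡⟨ +-comm (suc k * (suc n C suc k)) _ ⟩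
  suc n * (n C suc k) + suc k * (suc n C suc k) ∎
  where open ≡-Reasoning

[1+u]*[1+n]Cc≤[1+n]*nCc : ∀ {n u} c → c + u ≤ n → suc u * (suc n C c) ≤ suc n * (n C c)
[1+u]*[1+n]Cc≤[1+n]*nCc {n} {u} c c+u≤n = +-cancelʳ-≤ (c * X) _ _ (begin
  suc u * X + c * X      ≡⟨ *-distribʳ-+ X (suc u) c ⟨
  (suc u + c) * X        ≤⟨ *-monoˡ-≤ X (s≤s (subst (_≤ n) (+-comm c u) c+u≤n)) ⟩
  suc n * X              ≡⟨ [1+n]*[1+n]Ck≡[1+n]*nCk+k*[1+n]Ck n c ⟩
  suc n * (n C c) + c * X ∎)
  where
  open ≤-Reasoning
  X = suc n C c

module _ {n u : ℕ} where

  binomialSum-≤ : ∀ {cs} → All (λ c → c + u ≤ n) cs →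
                  suc u * sum (map (suc n C_) cs) ≤ suc n * sum (map (n C_) cs)
  binomialSum-≤ [] = ≤-reflexive (trans (*-zeroʳ (suc u)) (sym (*-zeroʳ (suc n))))
  binomialSum-≤ {c ∷ cs} (c+u≤n ∷ bounds) = begin
    suc u * (suc n C c + sum (map (suc n C_) cs))         ≡⟨ *-distribˡ-+ (suc u) (suc n C c) _ ⟩
    suc u * (suc n C c) + suc u * sum (map (suc n C_) cs) ≤⟨ +-mono-≤ ([1+u]*[1+n]Cc≤[1+n]*nCc c c+u≤n) (binomialSum-≤ bounds) ⟩
    suc n * (n C c) + suc n * sum (map (n C_) cs)         ≡⟨ *-distribˡ-+ (suc n) (n C c) _ ⟨
    suc n * (n C c + sum (map (n C_) cs))                 ∎
    where open ≤-Reasoning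

  binomialSum-< : ∀ {cs} → All (λ c → c + u ≤ n) cs → 0 ∈ cs → u < n →
                  suc u * sum (map (suc n C_) cs) < suc n * sum (map (n C_) cs)
  binomialSum-< {c ∷ cs} (c+u≤n ∷ bounds) (here refl) u<n = begin-strict
    suc u * (1 + sum (map (suc n C_) cs))         ≡⟨ *-distribˡ-+ (suc u) 1 _ ⟩
    suc u * 1 + suc u * sum (map (suc n C_) cs)   <⟨ +-mono-<-≤ u*1<n*1 (binomialSum-≤ bounds) ⟩
    suc n * 1 + suc n * sum (map (n C_) cs)       ≡⟨ *-distribˡ-+ (suc n) 1 _ ⟨
    suc n * (1 + sum (map (n C_) cs))             ∎
    where
    open ≤-Reasoning
    u*1<n*1 : suc u * 1 < suc n * 1
    u*1<n*1 = subst₂ _<_ (sym (*-identityʳ _)) (sym (*-identityʳ _)) (s≤s u<n)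
  binomialSum-< {c ∷ cs} (c+u≤n ∷ bounds) (there 0∈cs) u<n = begin-strict
    suc u * (suc n C c + sum (map (suc n C_) cs))         ≡⟨ *-distribˡ-+ (suc u) (suc n C c) _ ⟩
    suc u * (suc n C c) + suc u * sum (map (suc n C_) cs)
      <⟨ +-mono-≤-< ([1+u]*[1+n]Cc≤[1+n]*nCc c c+u≤n) (binomialSum-< bounds 0∈cs u<n) ⟩
    suc n * (n C c) + suc n * sum (map (n C_) cs)         ≡⟨ *-distribˡ-+ (suc n) (n C c) _ ⟨
    suc n * (n C c + sum (map (n C_) cs))                 ∎
    where open ≤-Reasoning

binomialSum-zeros : ∀ {n cs} → All (λ c → c + n ≤ n) cs → sum (map (n C_) cs) ≡ length cs
binomialSum-zeros [] = refl
binomialSum-zeros {n} {c ∷ cs} (c+n≤n ∷ bounds) =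
  cong₂ _+_ (cong (n C_) (n≤0⇒n≡0 (+-cancelʳ-≤ n c 0 c+n≤n))) (binomialSum-zeros bounds)

binomialSum-growth : ∀ {n u cs} → All (λ c → c + u ≤ n) cs → 0 ∈ cs → u < n ⊎ 2 ≤ length cs →
                     sum (map (n C_) cs) ≤ n C u → sum (map (suc n C_) cs) < suc n C suc u
binomialSum-growth {n} {u} {cs} bounds 0∈cs u<n⊎2≤|cs| S≤C = *-cancelˡ-< (suc u) _ _ (begin-strict
  suc u * sum (map (suc n C_) cs) <⟨ binomialSum-< bounds 0∈cs u<n ⟩
  suc n * sum (map (n C_) cs)     ≤⟨ *-monoʳ-≤ (suc n) S≤C ⟩
  suc n * (n C u)                 ≡⟨ [1+k]*[1+n]C[1+k]≡[1+n]*nCk n u ⟨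
  suc u * (suc n C suc u)         ∎)
  where
  open ≤-Reasoning
  u≢n : 2 ≤ length cs → u ≢ n
  u≢n 2≤|cs| refl = <-irrefl refl (≤-trans 2≤|cs| (begin
    length cs                ≡⟨ binomialSum-zeros bounds ⟨
    sum (map (n C_) cs)      ≤⟨ S≤C ⟩
    n C n                    ≡⟨ nCn≡1 n ⟩
    1                        ∎))
  u<n : u < n
  u<n = [ id , (λ 2≤|cs| → ≤∧≢⇒< (All.lookup bounds 0∈cs) (u≢n 2≤|cs|)) ] u<n⊎2≤|cs|

-- Counting lexicographic predecessors

-- The number of k-sets preceding, in ≺, the set with characteristic word w (see Lsize≡lexCount).
lexCount : List Bool → ℕ → ℕ
lexCount []           zero    = 1
lexCount []           (suc k) = 0
lexCount (true ∷ bs)  zero    = 0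
lexCount (true ∷ bs)  (suc k) = lexCount bs k
lexCount (false ∷ bs) zero    = lexCount bs zero
lexCount (false ∷ bs) (suc k) = length bs C k + lexCount bs (suc k)

module _ {n : ℕ} (b : Bool) (A B : Subset n) where

  ∷-≺-∷⁻ : (b ∷ A) ≺ (b ∷ B) → A ≺ B
  ∷-≺-∷⁻ (inj₁ B⊆A) = inj₁ (λ x∈B → tail (B⊆A (there x∈B)))
    where
    tail : ∀ {x} → suc x ∈ₛ (b ∷ A) → x ∈ₛ A
    tail (there x∈A) = x∈A
  ∷-≺-∷⁻ (inj₂ (zero , (here , 0∉bB) , _)) = ⊥-elim (0∉bB here)
  ∷-≺-∷⁻ (inj₂ (suc a , (there a∈A , a∉bB) , below)) =
    inj₂ (a , (a∈A , a∉bB ∘ there) ,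
          λ { c (c∈B , c∉A) → pred< (below (suc c) (there c∈B , λ { (there c∈A) → c∉A c∈A })) })
    where
    pred< : ∀ {x y : Fin n} → suc x <ᶠ suc y → x <ᶠ y
    pred< (s≤s x<y) = x<y

  ∷-≺-∷⁺ : A ≺ B → (b ∷ A) ≺ (b ∷ B)
  ∷-≺-∷⁺ (inj₁ B⊆A) = inj₁ λ { here → here ; (there x∈B) → there (B⊆A x∈B) }
  ∷-≺-∷⁺ (inj₂ (a , (a∈A , a∉B) , below)) =
    inj₂ (suc a , (there a∈A , λ { (there a∈B) → a∉B a∈B }) ,
          λ { zero (here , 0∉bA) → ⊥-elim (0∉bA here)
            ; (suc c) (there c∈B , c∉A) → s≤s (below c (c∈B , c∉A ∘ there)) })

inside-≺-outside : ∀ {n} (A B : Subset n) → (inside ∷ A) ≺ (outside ∷ B)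
inside-≺-outside A B = inj₂ (zero , (here , λ ()) , λ { (suc c) _ → s≤s z≤n })

outside-⊀-inside : ∀ {n} (A B : Subset n) → ¬ ((outside ∷ A) ≺ (inside ∷ B))
outside-⊀-inside A B (inj₁ B⊆A) with B⊆A here
... | ()
outside-⊀-inside A B (inj₂ (a , _ , below)) with below zero (here , λ ())
... | ()

countSubsets : ∀ {n} {P : Pred (Subset n) 0ℓ} → Decidable P → ℕ
countSubsets {n} P? = length (filter P? (allSubsets n))

length-filter-map : ∀ {A B : Set} {P : Pred B 0ℓ} (P? : Decidable P) (f : A → B) xs →
                    length (filter P? (map f xs)) ≡ length (filter (P? ∘ f) xs)
length-filter-map P? f []       = refl
length-filter-map P? f (x ∷ xs) with does (P? (f x))
... | true  = cong suc (length-filter-map P? f xs)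
... | false = length-filter-map P? f xs

module _ {n : ℕ} {P : Pred (Subset (suc n)) 0ℓ} (P? : Decidable P) where

  countSubsets-suc : countSubsets P? ≡ countSubsets (P? ∘ (inside ∷_)) + countSubsets (P? ∘ (outside ∷_))
  countSubsets-suc = begin
    length (filter P? (map (inside ∷_) S ++ map (outside ∷_) S))
      ≡⟨ cong length (filter-++ P? (map (inside ∷_) S) _) ⟩
    length (filter P? (map (inside ∷_) S) ++ filter P? (map (outside ∷_) S))
      ≡⟨ length-++ (filter P? (map (inside ∷_) S)) ⟩
    length (filter P? (map (inside ∷_) S)) + length (filter P? (map (outside ∷_) S))
      ≡⟨ cong₂ _+_ (length-filter-map P? (inside ∷_) S) (length-filter-map P? (outside ∷_) S) ⟩
    countSubsets (P? ∘ (inside ∷_)) + countSubsets (P? ∘ (outside ∷_)) ∎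
    where
    open ≡-Reasoning
    S : List (Subset n)
    S = allSubsets n

module _ {n : ℕ} {P Q : Pred (Subset n) 0ℓ} (P? : Decidable P) (Q? : Decidable Q) where

  countSubsets-cong : (∀ {F} → P F → Q F) → (∀ {F} → Q F → P F) → countSubsets P? ≡ countSubsets Q?
  countSubsets-cong P⇒Q Q⇒P = cong length (filter-≐ P? Q? (P⇒Q , Q⇒P) (allSubsets n))

countSubsets-none : ∀ {n} {P : Pred (Subset n) 0ℓ} (P? : Decidable P) → (∀ F → ¬ P F) → countSubsets P? ≡ 0
countSubsets-none {n} P? ¬P = cong length (filter-none P? (All.universal ¬P (allSubsets n)))

ofSize? : ∀ {n} k → Decidable (λ (F : Subset n) → ∣ F ∣ ≡ k)
ofSize? k F = ∣ F ∣ ≟ℕ k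

lexBefore? : ∀ {n} (R : Subset n) k → Decidable (λ F → ∣ F ∣ ≡ k × F ≺ R)
lexBefore? R k F = (∣ F ∣ ≟ℕ k) ×-dec (F ≺? R)

countSubsets-ofSize : ∀ n k → countSubsets (ofSize? {n} k) ≡ n C k
countSubsets-ofSize zero    zero    = refl
countSubsets-ofSize zero    (suc k) = refl
countSubsets-ofSize (suc n) zero    = trans (countSubsets-suc (ofSize? {suc n} 0))
  (cong₂ _+_ (countSubsets-none (ofSize? {suc n} 0 ∘ (inside ∷_)) λ _ ()) (countSubsets-ofSize n zero))
countSubsets-ofSize (suc n) (suc k) = begin
  countSubsets (ofSize? {suc n} (suc k))
    ≡⟨ countSubsets-suc (ofSize? {suc n} (suc k)) ⟩
  countSubsets (ofSize? {suc n} (suc k) ∘ (inside ∷_)) + countSubsets (ofSize? {n} (suc k))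
    ≡⟨ cong (_+ countSubsets (ofSize? {n} (suc k)))
            (countSubsets-cong (ofSize? {suc n} (suc k) ∘ (inside ∷_)) (ofSize? k) suc-injective (cong suc)) ⟩
  countSubsets (ofSize? {n} k) + countSubsets (ofSize? {n} (suc k))
    ≡⟨ cong₂ _+_ (countSubsets-ofSize n k) (countSubsets-ofSize n (suc k)) ⟩
  n C k + n C suc k
    ≡⟨ nCk+nC[k+1]≡[n+1]C[k+1] n k ⟩
  suc n C suc k ∎
  where open ≡-Reasoning

module _ {n : ℕ} (R : Subset n) where

  private
    outside-⊀ : ∀ {k} F → ¬ ((∣ F ∣ ≡ k) × ((outside ∷ F) ≺ (inside ∷ R)))
    outside-⊀ F (_ , F≺R) = outside-⊀-inside F R F≺R

    countSubsets-outside∷ : ∀ k → countSubsets (lexBefore? (outside ∷ R) k ∘ (outside ∷_)) ≡ Lsize n R k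
    countSubsets-outside∷ k = countSubsets-cong (lexBefore? (outside ∷ R) k ∘ (outside ∷_)) (lexBefore? R k)
      (λ (e , F≺R) → e , ∷-≺-∷⁻ false _ R F≺R) (λ (e , F≺R) → e , ∷-≺-∷⁺ false _ R F≺R)

  Lsize-inside-zero : Lsize (suc n) (inside ∷ R) 0 ≡ 0
  Lsize-inside-zero = trans (countSubsets-suc (lexBefore? (inside ∷ R) 0))
    (cong₂ _+_ (countSubsets-none (lexBefore? (inside ∷ R) 0 ∘ (inside ∷_)) λ { F (() , _) })
               (countSubsets-none (lexBefore? (inside ∷ R) 0 ∘ (outside ∷_)) outside-⊀))

  Lsize-inside-suc : ∀ k → Lsize (suc n) (inside ∷ R) (suc k) ≡ Lsize n R k
  Lsize-inside-suc k = trans (countSubsets-suc (lexBefore? (inside ∷ R) (suc k))) (trans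
    (cong₂ _+_ (countSubsets-cong (lexBefore? (inside ∷ R) (suc k) ∘ (inside ∷_)) (lexBefore? R k)
                  (λ (e , F≺R) → suc-injective e , ∷-≺-∷⁻ true _ R F≺R)
                  (λ (e , F≺R) → cong suc e , ∷-≺-∷⁺ true _ R F≺R))
               (countSubsets-none (lexBefore? (inside ∷ R) (suc k) ∘ (outside ∷_)) outside-⊀))
    (+-identityʳ _))

  Lsize-outside-zero : Lsize (suc n) (outside ∷ R) 0 ≡ Lsize n R 0
  Lsize-outside-zero = trans (countSubsets-suc (lexBefore? (outside ∷ R) 0))
    (cong₂ _+_ (countSubsets-none (lexBefore? (outside ∷ R) 0 ∘ (inside ∷_)) λ { F (() , _) })
               (countSubsets-outside∷ 0))

  Lsize-outside-suc : ∀ k → Lsize (suc n) (outside ∷ R) (suc k) ≡ n C k + Lsize n R (suc k)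
  Lsize-outside-suc k = trans (countSubsets-suc (lexBefore? (outside ∷ R) (suc k)))
    (cong₂ _+_ (trans (countSubsets-cong (lexBefore? (outside ∷ R) (suc k) ∘ (inside ∷_)) (ofSize? k)
                                         (λ (e , _) → suc-injective e)
                                         (λ {F} e → cong suc e , inside-≺-outside F R))
                      (countSubsets-ofSize n k))
               (countSubsets-outside∷ (suc k)))

Lsize≡lexCount : ∀ {n} (R : Subset n) k → Lsize n R k ≡ lexCount (toList R) k
Lsize≡lexCount []          zero    = refl
Lsize≡lexCount []          (suc k) = refl
Lsize≡lexCount (true ∷ R)  zero    = Lsize-inside-zero R
Lsize≡lexCount (true ∷ R)  (suc k) = trans (Lsize-inside-suc R k) (Lsize≡lexCount R k)
Lsize≡lexCount (false ∷ R) zero    = trans (Lsize-outside-zero R) (Lsize≡lexCount R zero)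
Lsize≡lexCount (false ∷ R) (suc k) = trans (Lsize-outside-suc R k)
  (cong₂ _+_ (cong (_C k) (sym (length-toList R))) (Lsize≡lexCount R (suc k)))

length-replicate-++ : ∀ L {b : Bool} bs → length (replicate L b ++ bs) ≡ L + length bs
length-replicate-++ L bs = trans (length-++ (replicate L _)) (cong (_+ length bs) (length-replicate L))

lexCount-falses : ∀ L bs k → lexCount (replicate L false ++ bs) k + length bs C k ≡ (L + length bs) C k + lexCount bs k
lexCount-falses zero    bs k       = +-comm (lexCount bs k) _
lexCount-falses (suc L) bs zero    = lexCount-falses L bs zero
lexCount-falses (suc L) bs (suc k) = begin
  length (replicate L false ++ bs) C k + lexCount (replicate L false ++ bs) (suc k) + length bs C suc k
    ≡⟨ +-assoc (length (replicate L false ++ bs) C k) _ _ ⟩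
  length (replicate L false ++ bs) C k + (lexCount (replicate L false ++ bs) (suc k) + length bs C suc k)
    ≡⟨ cong₂ _+_ (cong (_C k) (length-replicate-++ L bs)) (lexCount-falses L bs (suc k)) ⟩
  (L + length bs) C k + ((L + length bs) C suc k + lexCount bs (suc k))
    ≡⟨ +-assoc ((L + length bs) C k) _ _ ⟨
  (L + length bs) C k + (L + length bs) C suc k + lexCount bs (suc k)
    ≡⟨ cong (_+ lexCount bs (suc k)) (nCk+nC[k+1]≡[n+1]C[k+1] (L + length bs) k) ⟩
  suc (L + length bs) C suc k + lexCount bs (suc k) ∎
  where open ≡-Reasoning

lexCount-trues : ∀ L bs k → lexCount (replicate L true ++ bs) (L + k) ≡ lexCount bs k
lexCount-trues zero    bs k = refl
lexCount-trues (suc L) bs k = lexCount-trues L bs k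

lexCount-allFalse : ∀ G k → lexCount (replicate G false) k ≡ G C k
lexCount-allFalse zero    zero    = refl
lexCount-allFalse zero    (suc k) = refl
lexCount-allFalse (suc G) zero    = lexCount-allFalse G zero
lexCount-allFalse (suc G) (suc k) =
  trans (cong₂ _+_ (cong (_C k) (length-replicate G)) (lexCount-allFalse G (suc k)))
        (nCk+nC[k+1]≡[n+1]C[k+1] G k)

lexCount-allTrue : ∀ b → lexCount (replicate b true) b ≡ 1
lexCount-allTrue zero    = refl
lexCount-allTrue (suc b) = lexCount-allTrue b

lexCount-falses-trues : ∀ G b → lexCount (replicate G false ++ replicate b true) b ≡ (G + b) C b
lexCount-falses-trues G b = +-cancelʳ-≡ 1 _ _ (begin
  lexCount (replicate G false ++ replicate b true) b + 1
    ≡⟨ cong (lexCount (replicate G false ++ replicate b true) b +_) (sym (trans (cong (_C b) |T^b|) (nCn≡1 b))) ⟩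
  lexCount (replicate G false ++ replicate b true) b + length (replicate b true) C b
    ≡⟨ lexCount-falses G (replicate b true) b ⟩
  (G + length (replicate b true)) C b + lexCount (replicate b true) b
    ≡⟨ cong₂ _+_ (cong (λ l → (G + l) C b) |T^b|) (lexCount-allTrue b) ⟩
  (G + b) C b + 1 ∎)
  where
  open ≡-Reasoning
  |T^b| : length (replicate b true) ≡ b
  |T^b| = length-replicate b

-- The word of the partner of a set whose maximum has index q: flip the letters before q and
-- clear those after it.
partnerWord : ℕ → List Bool → List Bool
partnerWord _       []       = []
partnerWord zero    (b ∷ bs) = b ∷ replicate (length bs) false
partnerWord (suc q) (b ∷ bs) = not b ∷ partnerWord q bs

partnerWord-replicate-++ : ∀ L q b bs → partnerWord (L + q) (replicate L b ++ bs) ≡ replicate L (not b) ++ partnerWord q bs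
partnerWord-replicate-++ zero    q b bs = refl
partnerWord-replicate-++ (suc L) q b bs = cong (not b ∷_) (partnerWord-replicate-++ L q b bs)

partnerWord-trues : ∀ q bs → partnerWord q (replicate (suc q) true ++ bs) ≡ replicate q false ++ true ∷ replicate (length bs) false
partnerWord-trues zero    bs = refl
partnerWord-trues (suc q) bs = cong (false ∷_) (partnerWord-trues q bs)

lexCount-blocks : ∀ M a G b →
  lexCount (replicate M false ++ replicate a true ++ replicate G false ++ replicate b true) (a + b) + (a + (G + b)) C (a + b)
  ≡ (M + (a + (G + b))) C (a + b) + (G + b) C b
lexCount-blocks M a G b = begin
  lexCount (replicate M false ++ w) (a + b) + (a + (G + b)) C (a + b)
    ≡⟨ cong (λ l → lexCount (replicate M false ++ w) (a + b) + l C (a + b)) |w| ⟨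
  lexCount (replicate M false ++ w) (a + b) + length w C (a + b)
    ≡⟨ lexCount-falses M w (a + b) ⟩
  (M + length w) C (a + b) + lexCount w (a + b)
    ≡⟨ cong₂ _+_ (cong (λ l → (M + l) C (a + b)) |w|) (lexCount-trues a _ b) ⟩
  (M + (a + (G + b))) C (a + b) + lexCount (replicate G false ++ replicate b true) b
    ≡⟨ cong ((M + (a + (G + b))) C (a + b) +_) (lexCount-falses-trues G b) ⟩
  (M + (a + (G + b))) C (a + b) + (G + b) C b ∎
  where
  open ≡-Reasoning
  w : List Bool
  w = replicate a true ++ replicate G false ++ replicate b true
  |w| : length w ≡ a + (G + b)
  |w| = trans (length-replicate-++ a _) (cong (a +_) (trans (length-replicate-++ G _) (cong (G +_) (length-replicate b))))

lexCount-falses-true : ∀ b bs → lexCount (replicate b false ++ true ∷ bs) 0 ≡ 0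
lexCount-falses-true zero    bs = refl
lexCount-falses-true (suc b) bs = lexCount-falses-true b bs

lexCount-trues-≤ : ∀ L bs k → k ≤ L → lexCount bs 0 ≡ 0 → lexCount (replicate L true ++ bs) k ≡ 0
lexCount-trues-≤ zero    bs zero    _         bs₀≡0 = bs₀≡0
lexCount-trues-≤ (suc L) bs zero    _         _     = refl
lexCount-trues-≤ (suc L) bs (suc k) (s≤s k≤L) bs₀≡0 = lexCount-trues-≤ L bs k k≤L bs₀≡0

lexCount-partnerBlocks : ∀ M a G b c → suc c ≤ G →
  lexCount (replicate M true ++ replicate a false ++ replicate G true ++ replicate b false ++ true ∷ []) (M + suc c)
    + (G + suc b) C suc c
  ≡ (a + (G + suc b)) C suc c
lexCount-partnerBlocks M a G b c c<G = begin
  lexCount (replicate M true ++ replicate a false ++ v) (M + suc c) + (G + suc b) C suc c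
    ≡⟨ cong₂ _+_ (lexCount-trues M _ (suc c)) (cong (_C suc c) (sym |v|)) ⟩
  lexCount (replicate a false ++ v) (suc c) + length v C suc c
    ≡⟨ lexCount-falses a v (suc c) ⟩
  (a + length v) C suc c + lexCount v (suc c)
    ≡⟨ cong₂ _+_ (cong (λ l → (a + l) C suc c) |v|)
                 (lexCount-trues-≤ G _ (suc c) c<G (lexCount-falses-true b [])) ⟩
  (a + (G + suc b)) C suc c + 0
    ≡⟨ +-identityʳ _ ⟩
  (a + (G + suc b)) C suc c ∎
  where
  open ≡-Reasoning
  v : List Bool
  v = replicate G true ++ replicate b false ++ true ∷ []
  |v| : length v ≡ G + suc b
  |v| = trans (length-replicate-++ G _) (cong (G +_) (trans (length-replicate-++ b _) (+-comm b 1)))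

lexCount-partnerBlocks-last : ∀ M a G c →
  lexCount (replicate M true ++ replicate a false ++ true ∷ replicate G false) (M + suc c) + G C suc c
  ≡ (suc a + G) C suc c
lexCount-partnerBlocks-last M a G c = +-cancelʳ-≡ (G C c) _ _ (begin
  lexCount (replicate M true ++ replicate a false ++ v) (M + suc c) + G C suc c + G C c
    ≡⟨ +-assoc (lexCount (replicate M true ++ replicate a false ++ v) (M + suc c)) _ _ ⟩
  lexCount (replicate M true ++ replicate a false ++ v) (M + suc c) + (G C suc c + G C c)
    ≡⟨ cong₂ _+_ (lexCount-trues M _ (suc c)) (trans (+-comm (G C suc c) _) (nCk+nC[k+1]≡[n+1]C[k+1] G c)) ⟩
  lexCount (replicate a false ++ v) (suc c) + suc G C suc c
    ≡⟨ cong (λ l → lexCount (replicate a false ++ v) (suc c) + suc l C suc c) (length-replicate G) ⟨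
  lexCount (replicate a false ++ v) (suc c) + length v C suc c
    ≡⟨ lexCount-falses a v (suc c) ⟩
  (a + length v) C suc c + lexCount (replicate G false) c
    ≡⟨ cong₂ _+_ (cong (λ l → (a + suc l) C suc c) (length-replicate G)) (lexCount-allFalse G c) ⟩
  (a + suc G) C suc c + G C c
    ≡⟨ cong (λ l → l C suc c + G C c) (+-suc a G) ⟩
  (suc a + G) C suc c + G C c ∎)
  where
  open ≡-Reasoning
  v : List Bool
  v = true ∷ replicate G false

-- Characteristic words of intervals and partners

toList≡applyUpTo : ∀ {n} (R : Subset n) p → (∀ x → lookup R x ≡ p (toℕ x)) → toList R ≡ applyUpTo p n
toList≡applyUpTo []      p R≗p = refl
toList≡applyUpTo (b ∷ R) p R≗p = cong₂ _∷_ (R≗p zero) (toList≡applyUpTo R (p ∘ suc) (R≗p ∘ suc))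

applyUpTo-const : ∀ {f : ℕ → Bool} n b → (∀ y → f y ≡ b) → applyUpTo f n ≡ replicate n b
applyUpTo-const zero    b f≡b = refl
applyUpTo-const (suc n) b f≡b = cong₂ _∷_ (f≡b 0) (applyUpTo-const n b (f≡b ∘ suc))

∣∣≡length-filter-T : ∀ {n} (R : Subset n) → ∣ R ∣ ≡ length (filter T? (toList R))
∣∣≡length-filter-T []          = refl
∣∣≡length-filter-T (true ∷ R)  = cong suc (∣∣≡length-filter-T R)
∣∣≡length-filter-T (false ∷ R) = ∣∣≡length-filter-T R

length-filter-T-blocks : ∀ L a e → length (filter T? (replicate L false ++ replicate a true ++ replicate e false)) ≡ a
length-filter-T-blocks (suc L) a       e       = length-filter-T-blocks L a e
length-filter-T-blocks zero    (suc a) e       = cong suc (length-filter-T-blocks zero a e)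
length-filter-T-blocks zero    zero    (suc e) = length-filter-T-blocks zero zero e
length-filter-T-blocks zero    zero    zero    = refl

⌊⌋-reflects : ∀ {A : Set} {b} (d : Dec A) → Reflects A b → ⌊ d ⌋ ≡ b
⌊⌋-reflects (true  because p) r = det p r
⌊⌋-reflects (false because p) r = det p r

-- Index y of a Subset stands for the element suc y of [n], as in Defs.
between : ℕ → ℕ → ℕ → Bool
between lo hi y = (lo ≤ᵇ suc y) ∧ (suc y ≤ᵇ hi)

lookup-interval : ∀ n lo hi x → lookup (interval n lo hi) x ≡ between lo hi (toℕ x)
lookup-interval n lo hi x = trans (lookup∘tabulate _ x) (cong₂ _∧_ (does-≤? lo _) (does-≤? _ hi))
  where
  does-≤? : ∀ m n → ⌊ m ≤? n ⌋ ≡ (m ≤ᵇ n)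
  does-≤? m n = ⌊⌋-reflects (m ≤? n) (≤ᵇ-reflects-≤ m n)

between-true : ∀ {lo hi y} → lo ≤ suc y → suc y ≤ hi → between lo hi y ≡ true
between-true lo≤ ≤hi = Equivalence.to T-≡ (Equivalence.from T-∧ (≤⇒≤ᵇ lo≤ , ≤⇒≤ᵇ ≤hi))

between-bounds : ∀ {lo hi y} → T (between lo hi y) → lo ≤ suc y × suc y ≤ hi
between-bounds {lo} {hi} {y} t with Equivalence.to T-∧ t
... | lo≤ , ≤hi = ≤ᵇ⇒≤ lo (suc y) lo≤ , ≤ᵇ⇒≤ (suc y) hi ≤hi

applyUpTo-between : ∀ L a e → applyUpTo (between (suc L) (L + a)) (L + (a + e))
                              ≡ replicate L false ++ replicate a true ++ replicate e false
applyUpTo-between (suc L) a       e = cong (false ∷_) (applyUpTo-between L a e)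
applyUpTo-between zero    (suc a) e = cong (true ∷_) (applyUpTo-between zero a e)
applyUpTo-between zero    zero    e = applyUpTo-const e false λ _ → refl

applyUpTo-between-∨ : ∀ L a G b →
  applyUpTo (λ y → between (suc L) (L + a) y ∨ between (suc (L + (a + G))) (L + (a + (G + b))) y) (L + (a + (G + b)))
  ≡ replicate L false ++ replicate a true ++ replicate G false ++ replicate b true
applyUpTo-between-∨ (suc L) a       G b = cong (false ∷_) (applyUpTo-between-∨ L a G b)
applyUpTo-between-∨ zero    (suc a) G b = cong (true ∷_) (applyUpTo-between-∨ zero a G b)
applyUpTo-between-∨ zero    zero    G b = begin
  applyUpTo (between (suc G) (G + b)) (G + b)
    ≡⟨ cong (applyUpTo (between (suc G) (G + b)) ∘ (G +_)) (+-identityʳ b) ⟨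
  applyUpTo (between (suc G) (G + b)) (G + (b + 0))
    ≡⟨ applyUpTo-between G b 0 ⟩
  replicate G false ++ replicate b true ++ []
    ≡⟨ cong (replicate G false ++_) (++-identityʳ (replicate b true)) ⟩
  replicate G false ++ replicate b true ∎
  where open ≡-Reasoning

partnerPred : (ℕ → Bool) → ℕ → ℕ → Bool
partnerPred p q y = if p y then y ≡ᵇ q else y <ᵇ q

applyUpTo-partner : ∀ p q n → applyUpTo (partnerPred p q) n ≡ partnerWord q (applyUpTo p n)
applyUpTo-partner p q       zero    = refl
applyUpTo-partner p zero    (suc n) = cong₂ _∷_ (head (p 0)) (begin
  applyUpTo (λ y → if p (suc y) then false else false) n ≡⟨ applyUpTo-const n false (λ y → if-eta (p (suc y))) ⟩
  replicate n false                                     ≡⟨ cong (λ l → replicate l false) (length-applyUpTo (p ∘ suc) n) ⟨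
  replicate (length (applyUpTo (p ∘ suc) n)) false      ∎)
  where
  open ≡-Reasoning
  head : ∀ b → (if b then true else false) ≡ b
  head true  = refl
  head false = refl
applyUpTo-partner p (suc q) (suc n) = cong₂ _∷_ (head (p 0)) (applyUpTo-partner (p ∘ suc) q n)
  where
  head : ∀ b → (if b then false else true) ≡ not b
  head true  = refl
  head false = refl

module _ {n} (R : Subset n) (p : ℕ → Bool) (R≗p : ∀ x → lookup R x ≡ p (toℕ x))
         {q} (q<n : q < n) (p[q] : p q ≡ true) (q-max : ∀ y → y < n → p y ≡ true → y ≤ q) where

  private
    qᶠ : Fin n
    qᶠ = fromℕ< q<n

    ∈⇒p : ∀ {x} → x ∈ₛ R → p (toℕ x) ≡ true
    ∈⇒p {x} x∈R = trans (sym (R≗p x)) ([]=⇒lookup x∈R)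

    p⇒∈ : ∀ {x} → p (toℕ x) ≡ true → x ∈ₛ R
    p⇒∈ {x} px = lookup⇒[]= x R (trans (R≗p x) px)

    qᶠ∈R : qᶠ ∈ₛ R
    qᶠ∈R = p⇒∈ (trans (cong p (toℕ-fromℕ< q<n)) p[q])

    true≢false : ∀ {A : Set} → true ≡ false → A
    true≢false ()

    ≤q : ∀ {y} → y ∈ₛ R → toℕ y ≤ q
    ≤q {y} y∈R = q-max (toℕ y) (toℕ<n y) (∈⇒p y∈R)

  lookup-partner : ∀ x → lookup (partner R) x ≡ partnerPred p q (toℕ x)
  lookup-partner x = trans (lookup∘tabulate _ x) (⌊⌋-reflects _ (fromEquivalence to from))
    where
    IsPartner : Set
    IsPartner = (x ∈ₛ R × (∀ y → y ∈ₛ R → y ≤ᶠ x)) ⊎ (x ∉ₛ R × ∃ λ y → y ∈ₛ R × x <ᶠ y)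

    to : T (partnerPred p q (toℕ x)) → IsPartner
    to t with p (toℕ x) in px
    ... | true  = inj₁ (p⇒∈ px , λ y y∈R → subst (toℕ y ≤_) (sym (≡ᵇ⇒≡ _ _ t)) (≤q y∈R))
    ... | false = inj₂ ((λ x∈R → true≢false (trans (sym (∈⇒p x∈R)) px)) ,
                        qᶠ , qᶠ∈R , subst (toℕ x <_) (sym (toℕ-fromℕ< q<n)) (<ᵇ⇒< _ _ t))

    from : IsPartner → T (partnerPred p q (toℕ x))
    from (inj₁ (x∈R , x-max)) with p (toℕ x) in px
    ... | true  = ≡⇒≡ᵇ _ _ (≤-antisym (≤q x∈R) (subst (_≤ toℕ x) (toℕ-fromℕ< q<n) (x-max qᶠ qᶠ∈R)))
    ... | false = true≢false (trans (sym (∈⇒p x∈R)) px)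
    from (inj₂ (x∉R , y , y∈R , x<y)) with p (toℕ x) in px
    ... | true  = ⊥-elim (x∉R (p⇒∈ px))
    ... | false = <⇒<ᵇ (<-≤-trans x<y (≤q y∈R))

-- [n] cut into consecutive blocks of lengths M, a, G, b: X is the second block, and R, which adds the
-- last block, is the set f evaluates at X when k_i = a + b.
module Blocks (M a G b : ℕ) where

  n : ℕ
  n = M + (a + (G + b))

  X : Subset n
  X = interval n (suc M) (M + a)

  R : Subset n
  R = X ∪ interval n (suc (M + (a + G))) n

  word : List Bool
  word = replicate M false ++ replicate a true ++ replicate G false ++ replicate b true

  R-pred : ℕ → Bool
  R-pred y = between (suc M) (M + a) y ∨ between (suc (M + (a + G))) n y

  lookup-R : ∀ x → lookup R x ≡ R-pred (toℕ x)
  lookup-R x = trans (lookup-zipWith _∨_ x X _)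
    (cong₂ _∨_ (lookup-interval n (suc M) (M + a) x) (lookup-interval n (suc (M + (a + G))) n x))

  ∣X∣ : ∣ X ∣ ≡ a
  ∣X∣ = begin
    ∣ X ∣                                ≡⟨ ∣∣≡length-filter-T X ⟩
    length (filter T? (toList X))        ≡⟨ cong (length ∘ filter T?) (toList≡applyUpTo X _ (lookup-interval n (suc M) (M + a))) ⟩
    length (filter T? (applyUpTo (between (suc M) (M + a)) n))
                                         ≡⟨ cong (length ∘ filter T?) (applyUpTo-between M a (G + b)) ⟩
    length (filter T? (replicate M false ++ replicate a true ++ replicate (G + b) false))
                                         ≡⟨ length-filter-T-blocks M a (G + b) ⟩
    a                                    ∎
    where open ≡-Reasoning

  toList-R : toList R ≡ word
  toList-R = trans (toList≡applyUpTo R R-pred lookup-R) (applyUpTo-between-∨ M a G b)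

  Lsize-R : Lsize n R (a + b) + (a + (G + b)) C (a + b) ≡ n C (a + b) + (G + b) C b
  Lsize-R = trans (cong (_+ (a + (G + b)) C (a + b)) (trans (Lsize≡lexCount R (a + b)) (cong (λ w → lexCount w (a + b)) toList-R)))
                  (lexCount-blocks M a G b)

  toList-partner : ∀ q → q < n → (∀ y → y < n → R-pred y ≡ true → y ≤ q) → R-pred q ≡ true →
                   toList (partner R) ≡ partnerWord q word
  toList-partner q q<n q-max p[q] = trans (toList≡applyUpTo (partner R) _ (lookup-partner R R-pred lookup-R q<n p[q] q-max))
    (trans (applyUpTo-partner R-pred q n) (cong (partnerWord q) (applyUpTo-between-∨ M a G b)))

Lsize-partner : ∀ M a G b c → suc c ≤ G → 1 ≤ a + b → let open Blocks M a G b in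
                Lsize n (partner R) (M + suc c) + (G + b) C suc c ≡ (a + (G + b)) C suc c
Lsize-partner M a G (suc b) c c<G _ =
  trans (cong (_+ (G + suc b) C suc c)
              (trans (Lsize≡lexCount (partner R) (M + suc c)) (cong (λ w → lexCount w (M + suc c)) toList-partner-R)))
        (lexCount-partnerBlocks M a G b c c<G)
  where
  open Blocks M a G (suc b)
  q : ℕ
  q = M + (a + (G + b))
  n≡1+q : n ≡ suc q
  n≡1+q = trans (cong (λ l → M + (a + l)) (+-suc G b)) (trans (cong (M +_) (+-suc a _)) (+-suc M _))
  toList-partner-R : toList (partner R) ≡ replicate M true ++ replicate a false ++ replicate G true ++ replicate b false ++ true ∷ []
  toList-partner-R = begin
    toList (partner R)
      ≡⟨ toList-partner q (≤-reflexive (sym n≡1+q)) (λ y y<n _ → ≤-pred (subst (suc y ≤_) n≡1+q y<n))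
           (trans (cong (between (suc M) (M + a) q ∨_)
                        (between-true (s≤s (+-monoʳ-≤ M (+-monoʳ-≤ a (m≤m+n G b)))) (≤-reflexive (sym n≡1+q))))
                  (∨-zeroʳ _)) ⟩
    partnerWord (M + (a + (G + b))) word
      ≡⟨ partnerWord-replicate-++ M _ false _ ⟩
    replicate M true ++ partnerWord (a + (G + b)) (replicate a true ++ replicate G false ++ replicate (suc b) true)
      ≡⟨ cong (replicate M true ++_) (partnerWord-replicate-++ a _ true _) ⟩
    replicate M true ++ replicate a false ++ partnerWord (G + b) (replicate G false ++ replicate (suc b) true)
      ≡⟨ cong (λ w → replicate M true ++ replicate a false ++ w) (partnerWord-replicate-++ G _ false _) ⟩
    replicate M true ++ replicate a false ++ replicate G true ++ partnerWord b (replicate (suc b) true)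
      ≡⟨ cong (λ w → replicate M true ++ replicate a false ++ replicate G true ++ partnerWord b w) (++-identityʳ _) ⟨
    replicate M true ++ replicate a false ++ replicate G true ++ partnerWord b (replicate (suc b) true ++ [])
      ≡⟨ cong (λ w → replicate M true ++ replicate a false ++ replicate G true ++ w) (partnerWord-trues b []) ⟩
    replicate M true ++ replicate a false ++ replicate G true ++ replicate b false ++ true ∷ [] ∎
    where open ≡-Reasoning
Lsize-partner M (suc a) G zero c c<G _ = begin
  Lsize n (partner R) (M + suc c) + (G + 0) C suc c
    ≡⟨ cong₂ _+_ (trans (Lsize≡lexCount (partner R) (M + suc c)) (cong (λ w → lexCount w (M + suc c)) toList-partner-R))
                 (cong (_C suc c) (+-identityʳ G)) ⟩
  lexCount (replicate M true ++ replicate a false ++ true ∷ replicate G false) (M + suc c) + G C suc c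
    ≡⟨ lexCount-partnerBlocks-last M a G c ⟩
  (suc a + G) C suc c
    ≡⟨ cong (λ l → (suc a + l) C suc c) (+-identityʳ G) ⟨
  (suc a + (G + 0)) C suc c ∎
  where
  open ≡-Reasoning
  open Blocks M (suc a) G zero
  q : ℕ
  q = M + a
  q-max : ∀ y → y < n → R-pred y ≡ true → y ≤ q
  q-max y y<n R[y] with Equivalence.to (T-∨ {between (suc M) (M + suc a) y}) (Equivalence.from T-≡ R[y])
  ... | inj₁ t = ≤-pred (subst (suc y ≤_) (+-suc M a) (proj₂ (between-bounds {suc M} t)))
  ... | inj₂ t = ⊥-elim (≤⇒≯ (≤-pred (proj₁ (between-bounds {suc (M + (suc a + G))} {n} t)))
                              (subst (y <_) (cong (λ l → M + (suc a + l)) (+-identityʳ G)) y<n))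
  toList-partner-R : toList (partner R) ≡ replicate M true ++ replicate a false ++ true ∷ replicate G false
  toList-partner-R = begin
    toList (partner R)
      ≡⟨ toList-partner q (+-monoʳ-< M (s≤s (m≤m+n a (G + 0)))) q-max
           (cong (_∨ between (suc (M + (suc a + G))) n q) (between-true (s≤s (m≤m+n M a)) (≤-reflexive (sym (+-suc M a))))) ⟩
    partnerWord (M + a) word
      ≡⟨ partnerWord-replicate-++ M a false _ ⟩
    replicate M true ++ partnerWord a (replicate (suc a) true ++ replicate G false ++ [])
      ≡⟨ cong (replicate M true ++_) (partnerWord-trues a _) ⟩
    replicate M true ++ replicate a false ++ true ∷ replicate (length (replicate G false ++ [])) false
      ≡⟨ cong (λ l → replicate M true ++ replicate a false ++ true ∷ replicate l false)
              (trans (cong length (++-identityʳ (replicate G false))) (length-replicate G)) ⟩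
    replicate M true ++ replicate a false ++ true ∷ replicate G false ∎

-- The value of f on an interval

others : ∀ {t} → Fin t → List (Fin t)
others {t} i = filter (λ p → ¬? (p Finₚ.≟ i)) (allFin t)

length-others : ∀ {t} (i : Fin (suc t)) → length (others i) ≡ t
length-others {t} zero = trans
  (cong length (filter-all (λ p → ¬? (p Finₚ.≟ zero)) (tabulate⁺ {f = sucᶠ} λ _ ())))
  (length-tabulate sucᶠ)
  where
  sucᶠ : Fin t → Fin (suc t)
  sucᶠ = suc
length-others {suc t} (suc i) = cong suc (begin
  length (filter (λ p → ¬? (p Finₚ.≟ suc i)) (tabulate sucᶠ))
    ≡⟨ cong (length ∘ filter (λ p → ¬? (p Finₚ.≟ suc i))) (map-tabulate id sucᶠ) ⟨
  length (filter (λ p → ¬? (p Finₚ.≟ suc i)) (map suc (allFin (suc t))))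
    ≡⟨ length-filter-map (λ p → ¬? (p Finₚ.≟ suc i)) suc (allFin (suc t)) ⟩
  length (filter (λ p → ¬? (suc p Finₚ.≟ suc i)) (allFin (suc t)))
    ≡⟨ cong length (filter-≐ (λ p → ¬? (suc p Finₚ.≟ suc i)) (λ p → ¬? (p Finₚ.≟ i))
                             ((_∘ cong suc) , (_∘ Finₚ.suc-injective)) (allFin (suc t))) ⟩
  length (others i)
    ≡⟨ length-others i ⟩
  t ∎)
  where
  open ≡-Reasoning
  sucᶠ : Fin (suc t) → Fin (suc (suc t))
  sucᶠ = suc

k[p]+k[q]≤k₁+k₂ : ∀ {s} (k : Fin (2 + s) → ℕ) → (∀ p q → p ≤ᶠ q → k q ≤ k p) →
                  ∀ {p q} → p ≢ q → k p + k q ≤ k zero + k (suc zero)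
k[p]+k[q]≤k₁+k₂ k k-anti {p}     {suc q} _   = +-mono-≤ (k-anti zero p z≤n) (k-anti (suc zero) (suc q) (s≤s z≤n))
k[p]+k[q]≤k₁+k₂ k k-anti {suc p} {zero}  _   =
  subst (_≤ k zero + k (suc zero)) (+-comm (k zero) (k (suc p))) (+-monoʳ-≤ (k zero) (k-anti (suc zero) (suc p) (s≤s z≤n)))
k[p]+k[q]≤k₁+k₂ k k-anti {zero}  {zero}  0≢0 = ⊥-elim (0≢0 refl)

sum-map-+ : ∀ {A : Set} (f g : A → ℕ) xs → sum (map f xs) + sum (map g xs) ≡ sum (map (λ x → f x + g x) xs)
sum-map-+ f g []       = refl
sum-map-+ f g (x ∷ xs) = trans (interchange (f x) _ (g x) _) (cong (f x + g x +_) (sum-map-+ f g xs))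

x+c≡y+t∧x≤y⇒t≤c : ∀ {x y c t} → x + c ≡ y + t → x ≤ y → t ≤ c
x+c≡y+t∧x≤y⇒t≤c {x} {y} {c} {t} x+c≡y+t x≤y = +-cancelˡ-≤ y t c (subst (_≤ y + c) x+c≡y+t (+-monoˡ-≤ c x≤y))

x+c≡y+t∧t<c⇒x<y : ∀ {x y c t} → x + c ≡ y + t → t < c → x < y
x+c≡y+t∧t<c⇒x<y {x} {y} {c} {t} x+c≡y+t t<c = +-cancelʳ-< c x y (subst (_< y + c) (sym x+c≡y+t) (+-monoʳ-< y t<c))

module _ {t} (k : Fin t → ℕ) (i : Fin t) (M : ℕ) where

  offset : Fin t → ℕ
  offset p = k p ∸ suc M

  ΣC ΣC⁺ : ℕ → ℕ
  ΣC  x = sum (map (λ p → x C offset p) (others i))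
  ΣC⁺ x = sum (map (λ p → x C suc (offset p)) (others i))

  ΣC⁺-pascal : ∀ x → ΣC⁺ (suc x) ≡ ΣC x + ΣC⁺ x
  ΣC⁺-pascal x = sym (trans (sum-map-+ _ _ (others i))
    (cong sum (map-cong (λ p → nCk+nC[k+1]≡[n+1]C[k+1] x (offset p)) (others i))))

  -- For G = n − M − k_i this says m ≤ k_p ≤ n − k_i for p ≠ i.
  InRange : ℕ → Set
  InRange G = ∀ p → p ≢ i → suc M ≤ k p × k p ≤ M + G

  module _ {G} (inRange : InRange G) {p} (p≢i : p ≢ i) where

    k≡M+1+offset : k p ≡ M + suc (offset p)
    k≡M+1+offset = sym (trans (+-suc M (offset p)) (m+[n∸m]≡n (proj₁ (inRange p p≢i))))

    1+offset≤G : suc (offset p) ≤ G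
    1+offset≤G = +-cancelˡ-≤ M _ _ (subst (_≤ M + G) k≡M+1+offset (proj₂ (inRange p p≢i)))

  InRange-intro : ∀ {n G} → (∀ p → p ≢ i → suc M ≤ k p) → (∀ p → p ≢ i → k p + k i ≤ n) →
                  M + k i + G ≡ n → InRange G
  InRange-intro {G = G} m≤k k+k[i]≤n refl p p≢i =
    m≤k p p≢i , +-cancelʳ-≤ (k i) (k p) (M + G) (subst (k p + k i ≤_) (regroup M (k i) G) (k+k[i]≤n p p≢i))
    where
    regroup : ∀ M K G → M + K + G ≡ M + G + K
    regroup = solve-∀

  1<gap : ∀ {n G} → suc M + k i < n → M + k i + G ≡ n → 1 < G
  1<gap {G = G} 2+M+k[i]≤n refl = +-cancelˡ-≤ (M + k i) 2 G (subst (_≤ M + k i + G) (+-comm 2 (M + k i)) 2+M+k[i]≤n)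

  f-formula : ∀ n a G b → n ≡ M + (a + (G + b)) → k i ≡ a + b → 1 ≤ a + b → InRange G →
              f n k i (interval n (suc M) (M + a)) + (n ∸ M) C k i + ΣC⁺ (G + b)
              ≡ n C k i + (G + b) C b + ΣC⁺ (n ∸ M)
  f-formula _ a G b refl k[i] 1≤a+b inRange = begin
    f n k i X + (n ∸ M) C k i + ΣC⁺ (G + b)
      ≡⟨ cong (λ lo → f-i n k i (X ∪ interval n lo n) + (n ∸ M) C k i + ΣC⁺ (G + b)) lo≡ ⟩
    Lsize n R (k i) + Σpartner + (n ∸ M) C k i + ΣC⁺ (G + b)
      ≡⟨ +-assoc (Lsize n R (k i) + Σpartner) _ _ ⟩
    (Lsize n R (k i) + Σpartner) + ((n ∸ M) C k i + ΣC⁺ (G + b))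
      ≡⟨ interchange (Lsize n R (k i)) _ _ _ ⟩
    (Lsize n R (k i) + (n ∸ M) C k i) + (Σpartner + ΣC⁺ (G + b))
      ≡⟨ cong₂ _+_ Lsize-R′ Σpartner≡ ⟩
    n C k i + (G + b) C b + ΣC⁺ (n ∸ M) ∎
    where
    open ≡-Reasoning
    open Blocks M a G b
    Σpartner : ℕ
    Σpartner = sum (map (λ p → Lsize n (partner R) (k p)) (others i))

    n∸M≡ : n ∸ M ≡ a + (G + b)
    n∸M≡ = m+n∸m≡n M (a + (G + b))

    lo≡ : n ∸ k i + ∣ X ∣ + 1 ≡ suc (M + (a + G))
    lo≡ = begin
      n ∸ k i + ∣ X ∣ + 1                  ≡⟨ cong₂ (λ K x → n ∸ K + x + 1) k[i] ∣X∣ ⟩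
      n ∸ (a + b) + a + 1                  ≡⟨ cong (λ v → v ∸ (a + b) + a + 1) (regroup M a G b) ⟩
      (M + G) + (a + b) ∸ (a + b) + a + 1  ≡⟨ cong (λ v → v + a + 1) (m+n∸n≡m (M + G) (a + b)) ⟩
      M + G + a + 1                        ≡⟨ regroup′ M a G ⟩
      suc (M + (a + G))                    ∎
      where
      regroup : ∀ M a G b → M + (a + (G + b)) ≡ (M + G) + (a + b)
      regroup = solve-∀
      regroup′ : ∀ M a G → M + G + a + 1 ≡ suc (M + (a + G))
      regroup′ = solve-∀

    Lsize-R′ : Lsize n R (k i) + (n ∸ M) C k i ≡ n C k i + (G + b) C b
    Lsize-R′ rewrite k[i] | n∸M≡ = Lsize-R

    partner-summand : ∀ {p} → p ≢ i → Lsize n (partner R) (k p) + (G + b) C suc (offset p) ≡ (n ∸ M) C suc (offset p)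
    partner-summand {p} p≢i = begin
      Lsize n (partner R) (k p) + (G + b) C suc (offset p)
        ≡⟨ cong (λ K → Lsize n (partner R) K + (G + b) C suc (offset p)) (k≡M+1+offset inRange p≢i) ⟩
      Lsize n (partner R) (M + suc (offset p)) + (G + b) C suc (offset p)
        ≡⟨ Lsize-partner M a G b (offset p) (1+offset≤G inRange p≢i) 1≤a+b ⟩
      (a + (G + b)) C suc (offset p)
        ≡⟨ cong (_C suc (offset p)) n∸M≡ ⟨
      (n ∸ M) C suc (offset p) ∎

    Σpartner≡ : Σpartner + ΣC⁺ (G + b) ≡ ΣC⁺ (n ∸ M)
    Σpartner≡ = trans (sum-map-+ _ _ (others i))
      (cong sum (map-cong-local (All.map partner-summand (all-filter (λ p → ¬? (p Finₚ.≟ i)) (allFin t)))))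

  f-step : ∀ {n G j} a b → M + suc a ≡ j → suc a + b ≡ k i → M + k i + G ≡ n → InRange G →
           f n k i (interval n (suc M) j) + (G + b) C suc b ≡ f n k i (interval n (suc M) (j ∸ 1)) + ΣC (G + b)
  f-step {n} {G} a b refl 1+a+b≡k[i] refl inRange =
    trans (+-cancelʳ-≡ (Z + S) _ _ (begin
      (fⱼ + Q) + (Z + S)          ≡⟨ shuffle₁ fⱼ Q Z S ⟩
      fⱼ + Z + S + Q              ≡⟨ cong (_+ Q) fⱼ-formula ⟩
      W + P + V + Q               ≡⟨ shuffle₂ W P V Q ⟩
      W + (P + Q) + V             ≡⟨ cong (λ u → W + u + V) P+Q≡ ⟩
      W + (G + suc b) C suc b + V ≡⟨ fⱼ₋₁-formula ⟨
      fⱼ₋₁ + Z + ΣC⁺ (G + suc b)  ≡⟨ cong (fⱼ₋₁ + Z +_) (trans (cong ΣC⁺ (+-suc G b)) (ΣC⁺-pascal (G + b))) ⟩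
      fⱼ₋₁ + Z + (U + S)          ≡⟨ shuffle₃ fⱼ₋₁ Z U S ⟩
      (fⱼ₋₁ + U) + (Z + S)        ∎))
    (cong (λ x → f n k i (interval n (suc M) x) + U) (sym (cong (_∸ 1) (+-suc M a))))
    where
    open ≡-Reasoning
    fⱼ fⱼ₋₁ Z W V S U P Q : ℕ
    fⱼ   = f n k i (interval n (suc M) (M + suc a))
    fⱼ₋₁ = f n k i (interval n (suc M) (M + a))
    Z = (n ∸ M) C k i
    W = n C k i
    V = ΣC⁺ (n ∸ M)
    S = ΣC⁺ (G + b)
    U = ΣC (G + b)
    P = (G + b) C b
    Q = (G + b) C suc b

    P+Q≡ : P + Q ≡ (G + suc b) C suc b
    P+Q≡ = trans (nCk+nC[k+1]≡[n+1]C[k+1] (G + b) b) (cong (_C suc b) (sym (+-suc G b)))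

    split : ∀ a′ b′ → a′ + b′ ≡ k i → n ≡ M + (a′ + (G + b′))
    split a′ b′ a′+b′≡k[i] = trans (cong (λ K → M + K + G) (sym a′+b′≡k[i])) (regroup M a′ G b′)
      where
      regroup : ∀ M a G b → M + (a + b) + G ≡ M + (a + (G + b))
      regroup = solve-∀

    fⱼ-formula : fⱼ + Z + S ≡ W + P + V
    fⱼ-formula = f-formula n (suc a) G b (split (suc a) b 1+a+b≡k[i]) (sym 1+a+b≡k[i]) (s≤s z≤n) inRange

    a+1+b≡k[i] : a + suc b ≡ k i
    a+1+b≡k[i] = trans (+-suc a b) 1+a+b≡k[i]

    fⱼ₋₁-formula : fⱼ₋₁ + Z + ΣC⁺ (G + suc b) ≡ W + (G + suc b) C suc b + V
    fⱼ₋₁-formula = f-formula n a G (suc b) (split a (suc b) a+1+b≡k[i]) (sym a+1+b≡k[i])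
                     (subst (1 ≤_) (sym (+-suc a b)) (s≤s z≤n)) inRange

    shuffle₁ : ∀ x q z s → (x + q) + (z + s) ≡ x + z + s + q
    shuffle₁ = solve-∀
    shuffle₂ : ∀ w p v q → w + p + v + q ≡ w + (p + q) + v
    shuffle₂ = solve-∀
    shuffle₃ : ∀ y z u s → y + z + (u + s) ≡ (y + u) + (z + s)
    shuffle₃ = solve-∀

  f-decrease : ∀ {n G j} A B → M + suc (suc A) ≡ j → suc (suc A) + B ≡ k i → M + k i + G ≡ n → InRange G →
               (∃ λ p → p ≢ i × k p ≡ suc M) → 1 < G ⊎ 2 ≤ length (others i) →
               f n k i (interval n (suc M) j) ≤ f n k i (interval n (suc M) (j ∸ 1)) →
               f n k i (interval n (suc M) (j ∸ 1)) < f n k i (interval n (suc M) (j ∸ 2))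
  f-decrease {n} {G} {j} A B j≡ k[i]≡ n≡ inRange (p₀ , p₀≢i , k[p₀]≡1+M) 1<G⊎2≤|others| fⱼ≤fⱼ₋₁ =
    x+c≡y+t∧t<c⇒x<y step₂ growth′
    where
    step₁ : f n k i (interval n (suc M) j) + (G + B) C suc B ≡ f n k i (interval n (suc M) (j ∸ 1)) + ΣC (G + B)
    step₁ = f-step (suc A) B j≡ k[i]≡ n≡ inRange

    step₂ : f n k i (interval n (suc M) (j ∸ 1)) + (G + suc B) C suc (suc B)
            ≡ f n k i (interval n (suc M) (j ∸ 2)) + ΣC (G + suc B)
    step₂ = subst (λ x → f n k i (interval n (suc M) (j ∸ 1)) + (G + suc B) C suc (suc B)
                         ≡ f n k i (interval n (suc M) x) + ΣC (G + suc B))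
                  (∸-+-assoc j 1 1)
                  (f-step A (suc B) (trans (cong (_∸ 1) (sym (+-suc M (suc A)))) (cong (_∸ 1) j≡))
                          (trans (+-suc (suc A) B) k[i]≡) n≡ inRange)

    offsets : List ℕ
    offsets = map offset (others i)

    offset+1+B≤G+B : All (λ c → c + suc B ≤ G + B) offsets
    offset+1+B≤G+B = map⁺ (All.map (λ p≢i → subst (_≤ G + B) (sym (+-suc _ B)) (+-monoˡ-≤ B (1+offset≤G inRange p≢i)))
                                   (all-filter (λ p → ¬? (p Finₚ.≟ i)) (allFin t)))

    0∈offsets : 0 ∈ offsets
    0∈offsets = subst (_∈ offsets) (trans (cong (_∸ suc M) k[p₀]≡1+M) (n∸n≡0 (suc M)))
                      (∈-map⁺ offset (∈-filter⁺ (λ p → ¬? (p Finₚ.≟ i)) (∈-allFin p₀) p₀≢i))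

    ΣC≤ : sum (map ((G + B) C_) offsets) ≤ (G + B) C suc B
    ΣC≤ = subst (_≤ (G + B) C suc B) (cong sum (map-∘ (others i))) (x+c≡y+t∧x≤y⇒t≤c step₁ fⱼ≤fⱼ₋₁)

    growth : sum (map (suc (G + B) C_) offsets) < suc (G + B) C suc (suc B)
    growth = binomialSum-growth offset+1+B≤G+B 0∈offsets
        (Sum.map (+-monoˡ-< B) (subst (2 ≤_) (sym (length-map offset (others i)))) 1<G⊎2≤|others|) ΣC≤

    growth′ : ΣC (G + suc B) < (G + suc B) C suc (suc B)
    growth′ = subst₂ _<_ (sym (trans (cong ΣC (+-suc G B)) (cong sum (map-∘ (others i)))))
                         (cong (_C suc (suc B)) (sym (+-suc G B))) growth

lemma4 : (s : ℕ) (k : Fin (2 + s) → ℕ)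
         → (∀ p → 1 ≤ k p)
         → (∀ p q → p ≤ᶠ q → k q ≤ k p)
         → (n : ℕ) → k zero + k (suc zero) ≤ n
         → (i : Fin (2 + s))
         → (m : ℕ) → (∃ λ j → j ≢ i × k j ≡ m) → (∀ j → j ≢ i → m ≤ k j)
         → (k zero + k (suc zero) < n ⊎ 2 < 2 + s)
         → (j : ℕ) → m + 1 ≤ j → j ≤ (m + k i) ∸ 1
         → f n k i (interval n m j) ≤ f n k i (interval n m (j ∸ 1))
         → f n k i (interval n m (j ∸ 1)) < f n k i (interval n m (j ∸ 2))
lemma4 s k k≥1 k-anti n k₁+k₂≤n i zero (p₀ , _ , k[p₀]≡0) _ _ _ _ _ =
  ⊥-elim (1+n≰n (subst (1 ≤_) k[p₀]≡0 (k≥1 p₀)))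
lemma4 s k k≥1 k-anti n k₁+k₂≤n i (suc M) p₀@(_ , p₀≢i , k[p₀]≡1+M) m≤k k₁+k₂<n⊎2<2+s j 2+M≤j j≤M+k[i] =
  f-decrease k i M A B M+2+A≡j 2+A+B≡k[i] M+k[i]+G≡n (InRange-intro k i M m≤k k[p]+k[i]≤n M+k[i]+G≡n) p₀
    (Sum.map (λ k₁+k₂<n → 1<gap k i M (<-≤-trans (s≤s 1+M+k[i]≤k₁+k₂) k₁+k₂<n) M+k[i]+G≡n)
             2≤|others| k₁+k₂<n⊎2<2+s)
  where
  A B G : ℕ
  A = j ∸ suc (suc M)
  B = k i ∸ suc (suc A)
  G = n ∸ (M + k i)

  k[p]+k[i]≤n : ∀ p → p ≢ i → k p + k i ≤ n
  k[p]+k[i]≤n p p≢i = ≤-trans (k[p]+k[q]≤k₁+k₂ k k-anti p≢i) k₁+k₂≤n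

  1+M+k[i]≤k₁+k₂ : suc M + k i ≤ k zero + k (suc zero)
  1+M+k[i]≤k₁+k₂ = subst (λ x → x + k i ≤ k zero + k (suc zero)) k[p₀]≡1+M (k[p]+k[q]≤k₁+k₂ k k-anti p₀≢i)

  M+2+A≡j : M + suc (suc A) ≡ j
  M+2+A≡j = trans (+-suc M (suc A)) (trans (cong suc (+-suc M A)) (m+[n∸m]≡n (subst (_≤ j) (+-comm (suc M) 1) 2+M≤j)))

  2+A+B≡k[i] : suc (suc A) + B ≡ k i
  2+A+B≡k[i] = m+[n∸m]≡n (+-cancelˡ-≤ M _ _ (subst (_≤ M + k i) (sym M+2+A≡j) j≤M+k[i]))

  M+k[i]+G≡n : M + k i + G ≡ n
  M+k[i]+G≡n = m+[n∸m]≡n (≤-trans (n≤1+n _) (≤-trans 1+M+k[i]≤k₁+k₂ k₁+k₂≤n))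

  2≤|others| : 2 < 2 + s → 2 ≤ length (others i)
  2≤|others| 2<2+s = subst (2 ≤_) (sym (length-others i)) (s≤s (+-cancelˡ-≤ 2 1 s 2<2+s))
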